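{- Let $G$ be a finite abelian group and let $p$ be the smallest prime divisor of $|G|$. Let $S$ and $T$ be sequences over $G$, and suppose that $g\notin\langle\mathrm{supp}(S)\rangle$ for every term $g$ of $T$. Then $|\sum_0(T\cdot S)|\geq (|T|+1)\,|\sum_0(S)|$ if one of the following holds: (1) $|T|\leq p-1$; (2) $|T|\leq 2p-1$ and $\big|\langle\mathrm{supp}(T\cdot S)\rangle/\langle\mathrm{supp}(S)\rangle\big|\geq 2p$.
   Context: A sequence over $G$ is a finite unordered list of elements of $G$ with repetition allowed; $|T|$ is its length counted with multiplicity, $\mathrm{supp}(T)$ is the set of distinct elements occurring in $T$, and $T\cdot S$ denotes the concatenation (multiset union) of $T$ and $S$. $\sum(S)$ is the set of sums of all nonempty subsequences of $S$, and $\sum_0(S)=\sum(S)\cup\{0\}$. $\langle X\rangle$ denotes the subgroup generated by $X$. -}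

module Defs where

open import Level using (Level; _⊔_; suc)
open import Algebra.Bundles using (AbelianGroup)
open import Data.Nat using (ℕ)
open import Data.List using (List; []; _∷_; _++_; map; foldr; length; filter)
open import Data.List.Relation.Unary.Any using (Any; any?)
open import Data.List.Relation.Unary.All using (All)
open import Data.List.Relation.Unary.AllPairs using (AllPairs)
open import Relation.Nullary using (¬_)
open import Data.Product using (_×_)
open import Relation.Binary.Definitions using (Decidable)

record FiniteAbelianGroup (c ℓ : Level) : Set (Level.suc (c ⊔ ℓ)) where
  field
    abGroup  : AbelianGroup c ℓ
  open AbelianGroup abGroup public
  field
    _≟_      : Decidable _≈_
    elems    : List Carrier
    complete : ∀ x → Any (x ≈_) elems
    distinct : AllPairs (λ x y → ¬ x ≈ y) elems

  order : ℕ
  order = length elems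

  -- sequences over G are lists (order of terms is irrelevant to everything below)
  Seq : Set c
  Seq = List Carrier

  σ : Seq → Carrier
  σ = foldr _∙_ ε

  subseqs : Seq → List Seq
  subseqs []       = [] ∷ []
  subseqs (x ∷ xs) = subseqs xs ++ map (x ∷_) (subseqs xs)

  -- Σ₀(S) = Σ(S) ∪ {0}: sums of all subsequences (empty subsequence gives 0)
  Σ₀list : Seq → List Carrier
  Σ₀list S = map σ (subseqs S)

  _∈Σ₀_ : Carrier → Seq → Set (c ⊔ ℓ)
  g ∈Σ₀ S = Any (g ≈_) (Σ₀list S)

  ∣Σ₀_∣ : Seq → ℕ
  ∣Σ₀ S ∣ = length (filter (λ g → any? (g ≟_) (Σ₀list S)) elems)

  data ⟨_⟩ (X : Seq) : Carrier → Set (c ⊔ ℓ) where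
    gen  : ∀ {x} → Any (x ≈_) X → ⟨ X ⟩ x
    unit : ⟨ X ⟩ ε
    mul  : ∀ {x y} → ⟨ X ⟩ x → ⟨ X ⟩ y → ⟨ X ⟩ (x ∙ y)
    inv  : ∀ {x} → ⟨ X ⟩ x → ⟨ X ⟩ (x ⁻¹)
    resp : ∀ {x y} → x ≈ y → ⟨ X ⟩ x → ⟨ X ⟩ y

  -- L is an enumeration (duplicate-free list) of the subset P of G,
  -- so that |P| = length L
  Enumerates : (Carrier → Set (c ⊔ ℓ)) → List Carrier → Set (c ⊔ ℓ)
  Enumerates P L = AllPairs (λ x y → ¬ x ≈ y) L × All P L × (∀ x → P x → Any (x ≈_) L)

{-# OPTIONS --safe #-}
-- Write H = ⟨S⟩. For d ∈ Σ₀(T) the sets d + Σ₀(S) lie in Σ₀(T·S), and they are disjoint for d in distinct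
-- cosets of H; so it suffices that Σ₀(T) meets |T| + 1 cosets of H. Adding the terms of T one at a time, a
-- new term x either makes Σ₀ meet one more coset, or the set Σ₀ + H is invariant under translation by x.
-- In the latter case it contains the cosets of 0, x, ..., (p-1) x, which are distinct since no m x with
-- 0 < m < p lies in H, p being the smallest prime divisor of |G|. From then on, an element of Σ₀ or a later
-- term outside ⟨x⟩ + H produces 2p distinct cosets; and if Σ₀(T) stays inside ⟨x⟩ + H, then so does
-- ⟨T·S⟩, so under hypothesis (2) the order of x modulo H is at least 2p, giving 2p cosets again.
module Submission where

open import Defs
open import Level using (_⊔_)
open import Data.Nat using (ℕ; zero; suc; _≤_; _<_; _*_; _+_; _∸_; z≤n; s≤s; NonZero; >-nonZero)
import Data.Nat.Properties as ℕ
open import Data.List using (List; []; _∷_; [_]; length; _++_; map; filter; upTo; applyUpTo)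
import Data.List.Properties as List
open import Data.List.Relation.Unary.All as All using (All; []; _∷_)
open import Data.List.Relation.Unary.Any as Any using (Any; here; there; any?)
import Data.List.Relation.Unary.Any.Properties as Any
import Data.List.Relation.Unary.All.Properties as All
open import Data.List.Relation.Unary.AllPairs as AllPairs using (AllPairs; []; _∷_)
import Data.List.Relation.Unary.AllPairs.Properties as AllPairs
open import Data.Product as Product using (Σ; ∃; _×_; _,_; proj₁)
open import Data.Sum as Sum using (_⊎_; inj₁; inj₂; [_,_]′)
open import Data.Empty using (⊥-elim)
open import Relation.Nullary using (¬_; Dec; yes; no)
open import Relation.Nullary.Decidable using (decidable-stable)
open import Relation.Binary.Bundles using (Setoid)
open import Relation.Binary.PropositionalEquality as ≡ using (_≡_)
open import Data.Nat.Divisibility using (_∣_; ∣-trans; ∣⇒≤; 0∣⇒≡0; m∣m*n)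
open import Data.Nat.Primality using (Prime; prime⇒nonZero)
open import Data.Nat.Primality.Factorisation using (factorise)
open import Data.Nat.ListAction using (product)

module UniqueLists {a ℓ} (A : Setoid a ℓ) where
  open Setoid A
  open import Data.List.Membership.Setoid A using (_∈_)
  open import Data.List.Relation.Unary.Unique.Setoid A public using (Unique)
  open import Data.List.Relation.Binary.Permutation.Setoid A public using (_↭_)
  open import Data.List.Relation.Binary.Permutation.Setoid A using (prep; ↭-refl; ↭-trans)
  open import Data.List.Relation.Binary.Permutation.Setoid.Properties A using (shift; xs↭ys⇒|xs|≡|ys|)
  import Data.List.Membership.Propositional as Prop
  import Data.List.Membership.Propositional.Properties as Prop

  ∈-split : ∀ {x xs} → x ∈ xs → ∃ λ ys → ∃ λ y → ∃ λ zs → xs ≡ ys ++ y ∷ zs × x ≈ y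
  ∈-split x∈xs with y , y∈xs , x≈y ← Prop.find x∈xs with ys , zs , xs≡ ← Prop.∈-∃++ y∈xs =
    ys , y , zs , xs≡ , x≈y

  ∈-++-∷⁻ : ∀ {x} ys y zs → x ∈ ys ++ y ∷ zs → x ≈ y ⊎ x ∈ ys ++ zs
  ∈-++-∷⁻ []       y zs (here x≈y)   = inj₁ x≈y
  ∈-++-∷⁻ []       y zs (there x∈zs) = inj₂ x∈zs
  ∈-++-∷⁻ (w ∷ ys) y zs (here x≈w)   = inj₂ (here x≈w)
  ∈-++-∷⁻ (w ∷ ys) y zs (there x∈)   with ∈-++-∷⁻ ys y zs x∈
  ... | inj₁ x≈y = inj₁ x≈y
  ... | inj₂ x∈′ = inj₂ (there x∈′)

  unique-⊆⇒↭++ : ∀ {xs ys} → Unique xs → All (_∈ ys) xs → ∃ λ zs → ys ↭ xs ++ zs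
  unique-⊆⇒↭++ {[]}     {ys} _ _ = ys , ↭-refl
  unique-⊆⇒↭++ {x ∷ xs} (x≉xs ∷ u) (x∈ys ∷ xs⊆ys) with ∈-split x∈ys
  ... | us , y , vs , ≡.refl , x≈y with unique-⊆⇒↭++ u (All.zipWith remove (x≉xs , xs⊆ys))
    where
      remove : ∀ {w} → ¬ x ≈ w × w ∈ us ++ y ∷ vs → w ∈ us ++ vs
      remove (x≉w , w∈) with ∈-++-∷⁻ us y vs w∈
      ... | inj₁ w≈y = ⊥-elim (x≉w (trans x≈y (sym w≈y)))
      ... | inj₂ w∈′ = w∈′
  ... | zs , ↭zs = zs , ↭-trans (shift refl us vs) (prep (sym x≈y) ↭zs)

  unique-⊆⇒length-≤ : ∀ {xs ys} → Unique xs → All (_∈ ys) xs → length xs ≤ length ys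
  unique-⊆⇒length-≤ {xs} {ys} u xs⊆ys with zs , ys↭ ← unique-⊆⇒↭++ u xs⊆ys = begin
    length xs              ≤⟨ ℕ.m≤m+n (length xs) (length zs) ⟩
    length xs + length zs  ≡⟨ List.length-++ xs ⟨
    length (xs ++ zs)      ≡⟨ xs↭ys⇒|xs|≡|ys| ys↭ ⟨
    length ys              ∎
    where open ℕ.≤-Reasoning

  unique-⊆-same-length⇒↭ : ∀ {xs ys} → Unique xs → All (_∈ ys) xs → length ys ≡ length xs → ys ↭ xs
  unique-⊆-same-length⇒↭ {xs} {ys} u xs⊆ys |ys|≡|xs| with unique-⊆⇒↭++ u xs⊆ys
  ... | [] , ys↭ = ≡.subst (_ ↭_) (List.++-identityʳ xs) ys↭
  ... | z ∷ zs , ys↭ = ⊥-elim (ℕ.m+1+n≢m (length xs) (begin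
    length xs + suc (length zs)  ≡⟨ List.length-++ xs ⟨
    length (xs ++ z ∷ zs)        ≡⟨ xs↭ys⇒|xs|≡|ys| ys↭ ⟨
    length ys                    ≡⟨ |ys|≡|xs| ⟩
    length xs                    ∎))
    where open ≡.≡-Reasoning

∃-prime-divisor : ∀ n → 2 ≤ n → ∃ λ q → Prime q × q ∣ n
∃-prime-divisor (suc zero) (s≤s ())
∃-prime-divisor n@(suc (suc _)) _ with factorise n
... | record { factors = [] ; isFactorisation = () }
... | record { factors = q ∷ qs ; isFactorisation = n≡q*Πqs ; factorsPrime = q-prime ∷ _ } =
  q , q-prime , ≡.subst (q ∣_) (≡.sym n≡q*Πqs) (m∣m*n (product qs))

module FiniteAbelianGroupProperties {c ℓ} (G : FiniteAbelianGroup c ℓ) where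
  open FiniteAbelianGroup G
  open import Algebra.Properties.Group group using (∙-cancelˡ; x≈z//y; //-rightDividesˡ; inverseʳ-unique)
  open import Algebra.Properties.CommutativeSemigroup commutativeSemigroup using (interchange)
  open import Algebra.Properties.Monoid.Mult monoid public
    using (×-homo-+; ×-assocˡ) renaming (_×_ to _·_)
  open import Data.List.Membership.Setoid setoid public using (_∈_)
  open import Data.List.Relation.Binary.Permutation.Setoid.Properties setoid using (foldr-commMonoid)
  open import Data.List.Membership.Setoid.Properties using (∈-length)
  open import Data.Nat.GCD using (gcd; gcd-GCD; gcd[m,n]∣m; gcd[m,n]∣n; module Bézout)
  open import Relation.Nullary.Decidable using (¬¬-excluded-middle; map′)
  open UniqueLists setoid
  import Relation.Binary.Reasoning.Setoid setoid as ≈-Reasoning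

  instance
    order-nonZero : NonZero order
    order-nonZero = >-nonZero (∈-length setoid (complete ε))

  ⟨⟩-·-closed : ∀ {X x} n → ⟨ X ⟩ x → ⟨ X ⟩ (n · x)
  ⟨⟩-·-closed zero    x∈ = unit
  ⟨⟩-·-closed (suc n) x∈ = mul x∈ (⟨⟩-·-closed n x∈)

  ⟨⟩-·-∸-closed : ∀ {X x} i j k → i + k ≡ j → ⟨ X ⟩ (j · x) → ⟨ X ⟩ (k · x) → ⟨ X ⟩ (i · x)
  ⟨⟩-·-∸-closed {x = x} i j k i+k≡j jx∈ kx∈ = resp (sym (x≈z//y _ _ _ i·x∙k·x≈j·x)) (mul jx∈ (inv kx∈))
    where
      i·x∙k·x≈j·x : i · x ∙ k · x ≈ j · x
      i·x∙k·x≈j·x = trans (sym (×-homo-+ x i k)) (reflexive (≡.cong (_· x) i+k≡j))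

  ⟨⟩-·-*-closed : ∀ {X x} m n → ⟨ X ⟩ (n · x) → ⟨ X ⟩ ((m * n) · x)
  ⟨⟩-·-*-closed {x = x} m n nx∈ = resp (×-assocˡ x m n) (⟨⟩-·-closed m nx∈)

  ⟨⟩-·-gcd-closed : ∀ {X x} m n → ⟨ X ⟩ (m · x) → ⟨ X ⟩ (n · x) → ⟨ X ⟩ (gcd m n · x)
  ⟨⟩-·-gcd-closed m n mx∈ nx∈ with Bézout.identity (gcd-GCD m n)
  ... | Bézout.Identity.+- u v eq =
    ⟨⟩-·-∸-closed _ (u * m) (v * n) eq (⟨⟩-·-*-closed u m mx∈) (⟨⟩-·-*-closed v n nx∈)
  ... | Bézout.Identity.-+ u v eq =
    ⟨⟩-·-∸-closed _ (v * n) (u * m) eq (⟨⟩-·-*-closed v n nx∈) (⟨⟩-·-*-closed u m mx∈)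

  σ-map-∙ʳ : ∀ x xs → σ (map (_∙ x) xs) ≈ σ xs ∙ length xs · x
  σ-map-∙ʳ x []       = sym (identityˡ ε)
  σ-map-∙ʳ x (y ∷ xs) = trans (∙-congˡ (σ-map-∙ʳ x xs)) (interchange y x (σ xs) (length xs · x))

  -- Translation by x permutes G, so σ(G) ∙ |G| x ≈ σ(G).
  order·≈ε : ∀ x → order · x ≈ ε
  order·≈ε x = sym (∙-cancelˡ (σ elems) ε (order · x) (begin
    σ elems ∙ ε             ≈⟨ identityʳ (σ elems) ⟩
    σ elems                 ≈⟨ foldr-commMonoid isCommutativeMonoid translation ⟨
    σ (map (_∙ x) elems)    ≈⟨ σ-map-∙ʳ x elems ⟩
    σ elems ∙ order · x     ∎))
    where
      open ≈-Reasoning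
      ∈-translate : ∀ g → g ∈ map (_∙ x) elems
      ∈-translate g = Any.map⁺ (Any.map (λ g//x≈y → trans (sym (//-rightDividesˡ x g)) (∙-congʳ g//x≈y))
                                        (complete (g ∙ x ⁻¹)))
      translation : map (_∙ x) elems ↭ elems
      translation = unique-⊆-same-length⇒↭ distinct (All.tabulate (λ {g} _ → ∈-translate g))
                                             (List.length-map (_∙ x) elems)

  module _ {p} (p-minimal : ∀ q → Prime q → q ∣ order → p ≤ q) where

    -- gcd(m, |G|) x lies in ⟨X⟩ and is x itself unless gcd(m, |G|) has a prime factor, which is ≥ p > m.
    ·∉⟨⟩ : ∀ {X x} → ¬ ⟨ X ⟩ x → ∀ {m} → 1 ≤ m → m < p → ¬ ⟨ X ⟩ (m · x)
    ·∉⟨⟩ {X} {x} x∉ {m} 1≤m m<p mx∈ =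
      gcd-∉ (gcd m order) (gcd[m,n]∣m m order) (gcd[m,n]∣n m order)
            (⟨⟩-·-gcd-closed m order mx∈ (resp (sym (order·≈ε x)) unit))
      where
        gcd-∉ : ∀ d → d ∣ m → d ∣ order → ¬ ⟨ X ⟩ (d · x)
        gcd-∉ zero          0∣m _       _   = ℕ.<⇒≢ 1≤m (≡.sym (0∣⇒≡0 0∣m))
        gcd-∉ (suc zero)    _   _       x∈′ = x∉ (resp (identityʳ x) x∈′)
        gcd-∉ d@(suc (suc _)) d∣m d∣order _ with q , q-prime , q∣d ← ∃-prime-divisor d (s≤s (s≤s z≤n)) =
          ℕ.<⇒≱ m<p (begin
            p            ≤⟨ p-minimal q q-prime (∣-trans q∣d d∣order) ⟩
            q            ≤⟨ ∣⇒≤ q∣d ⟩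
            d            ≤⟨ ∣⇒≤ {{>-nonZero 1≤m}} d∣m ⟩
            m            ∎)
          where open ℕ.≤-Reasoning

  ·-∸-inverse : ∀ x {i} → i ≤ order → (order ∸ i) · x ≈ (i · x) ⁻¹
  ·-∸-inverse x {i} i≤order = inverseʳ-unique (i · x) ((order ∸ i) · x) (begin
    i · x ∙ (order ∸ i) · x   ≈⟨ ×-homo-+ x i (order ∸ i) ⟨
    (i + (order ∸ i)) · x     ≡⟨ ≡.cong (_· x) (ℕ.m+[n∸m]≡n i≤order) ⟩
    order · x                 ≈⟨ order·≈ε x ⟩
    ε                         ∎)
    where open ≈-Reasoning

  infixl 6 _⊕_
  _⊕_ : List Carrier → List Carrier → List Carrier
  []      ⊕ B = []
  (d ∷ D) ⊕ B = map (d ∙_) B ++ D ⊕ B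

  length-⊕ : ∀ D B → length (D ⊕ B) ≡ length D * length B
  length-⊕ []      B = ≡.refl
  length-⊕ (d ∷ D) B =
    ≡.trans (List.length-++ (map (d ∙_) B)) (≡.cong₂ _+_ (List.length-map (d ∙_) B) (length-⊕ D B))

  All-⊕⁺ : ∀ {q} {P : Carrier → Set q} {D B} → All (λ d → All (λ b → P (d ∙ b)) B) D → All P (D ⊕ B)
  All-⊕⁺ []             = []
  All-⊕⁺ (Pd∙B ∷ PD∙B) = All.++⁺ (All.map⁺ Pd∙B) (All-⊕⁺ PD∙B)

  ∈-⊕⁺ : ∀ {D B d b} → d ∈ D → b ∈ B → d ∙ b ∈ D ⊕ B
  ∈-⊕⁺ {d′ ∷ D} {B} (here d≈d′) b∈ = Any.++⁺ˡ (Any.map⁺ (Any.map (∙-cong d≈d′) b∈))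
  ∈-⊕⁺ {d′ ∷ D} {B} (there d∈)  b∈ = Any.++⁺ʳ (map (d′ ∙_) B) (∈-⊕⁺ d∈ b∈)

  ¬¬-decidable : ∀ {q} {P : Carrier → Set q} → (∀ {x y} → x ≈ y → P x → P y) → ¬ ¬ (∀ g → Dec (P g))
  ¬¬-decidable {P = P} P-resp ¬dec = ¬¬-decidable-on elems (λ dec → ¬dec (λ g → dec g (complete g)))
    where
      ¬¬-decidable-on : ∀ xs → ¬ ¬ (∀ g → g ∈ xs → Dec (P g))
      ¬¬-decidable-on []       ¬dec′ = ¬dec′ (λ _ ())
      ¬¬-decidable-on (y ∷ ys) ¬dec′ = ¬¬-excluded-middle λ P?y → ¬¬-decidable-on ys λ dec → ¬dec′ λ where
        g (here g≈y)  → map′ (P-resp (sym g≈y)) (P-resp g≈y) P?y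
        g (there g∈ys) → dec g g∈ys

module SubsetSums {c ℓ} (G : FiniteAbelianGroup c ℓ) where
  open FiniteAbelianGroup G
  open FiniteAbelianGroupProperties G using (_∈_)
  open UniqueLists setoid using (Unique)
  open import Data.List.Membership.Setoid setoid using (find)
  open import Data.List.Membership.Setoid.Properties using (∈-filter⁺)

  Σ₀list-∷ : ∀ x U → Σ₀list (x ∷ U) ≡ Σ₀list U ++ map (x ∙_) (Σ₀list U)
  Σ₀list-∷ x U = ≡.trans (List.map-++ σ (subseqs U) (map (x ∷_) (subseqs U)))
    (≡.cong (Σ₀list U ++_) (≡.trans (≡.sym (List.map-∘ (subseqs U))) (List.map-∘ (subseqs U))))

  module _ {q} {Q : Carrier → Set q} where

    Any-Σ₀-∷⁺ˡ : ∀ {x U} → Any Q (Σ₀list U) → Any Q (Σ₀list (x ∷ U))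
    Any-Σ₀-∷⁺ˡ {x} {U} h = ≡.subst (Any Q) (≡.sym (Σ₀list-∷ x U)) (Any.++⁺ˡ h)

    Any-Σ₀-∷⁺ʳ : ∀ {x U} → Any (λ z → Q (x ∙ z)) (Σ₀list U) → Any Q (Σ₀list (x ∷ U))
    Any-Σ₀-∷⁺ʳ {x} {U} h = ≡.subst (Any Q) (≡.sym (Σ₀list-∷ x U)) (Any.++⁺ʳ (Σ₀list U) (Any.map⁺ h))

    Any-Σ₀-∷⁻ : ∀ {x U} → Any Q (Σ₀list (x ∷ U)) → Any Q (Σ₀list U) ⊎ Any (λ z → Q (x ∙ z)) (Σ₀list U)
    Any-Σ₀-∷⁻ {x} {U} h with Any.++⁻ (Σ₀list U) (≡.subst (Any Q) (Σ₀list-∷ x U) h)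
    ... | inj₁ h′ = inj₁ h′
    ... | inj₂ h′ = inj₂ (Any.map⁻ h′)

    Any-Σ₀-ε : ∀ U → Q ε → Any Q (Σ₀list U)
    Any-Σ₀-ε []      Qε = here Qε
    Any-Σ₀-ε (x ∷ U) Qε = Any-Σ₀-∷⁺ˡ {x} {U} (Any-Σ₀-ε U Qε)

    All-Σ₀-∷⁺ : ∀ {x U} → All Q (Σ₀list U) → All (λ z → Q (x ∙ z)) (Σ₀list U) → All Q (Σ₀list (x ∷ U))
    All-Σ₀-∷⁺ {x} {U} a b = ≡.subst (All Q) (≡.sym (Σ₀list-∷ x U)) (All.++⁺ a (All.map⁺ b))

  ε∈Σ₀ : ∀ U → ε ∈Σ₀ U
  ε∈Σ₀ U = Any-Σ₀-ε U refl

  term∈Σ₀ : ∀ {g} U → g ∈ U → g ∈Σ₀ U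
  term∈Σ₀ (u ∷ U) (here g≈u)  = Any-Σ₀-∷⁺ʳ {x = u} {U} (Any-Σ₀-ε U (trans g≈u (sym (identityʳ u))))
  term∈Σ₀ (u ∷ U) (there g∈U) = Any-Σ₀-∷⁺ˡ {x = u} {U} (term∈Σ₀ U g∈U)

  ∙-∈Σ₀-++ : ∀ T {S d b} → d ∈Σ₀ T → b ∈Σ₀ S → (d ∙ b) ∈Σ₀ (T ++ S)
  ∙-∈Σ₀-++ []      (here d≈ε) b∈ = Any.map (trans (trans (∙-congʳ d≈ε) (identityˡ _))) b∈
  ∙-∈Σ₀-++ (x ∷ T) {S} d∈ b∈ with Any-Σ₀-∷⁻ {x = x} {T} d∈
  ... | inj₁ d∈′ = Any-Σ₀-∷⁺ˡ {x = x} {T ++ S} (∙-∈Σ₀-++ T d∈′ b∈)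
  ... | inj₂ d∈′ with z , z∈ , d≈x∙z ← find d∈′ =
    Any-Σ₀-∷⁺ʳ {x = x} {T ++ S} (Any.map (λ z∙b≈ → trans (trans (∙-congʳ d≈x∙z) (assoc _ _ _)) (∙-congˡ z∙b≈))
                                         (∙-∈Σ₀-++ T z∈ b∈))

  Σ₀⊆⟨⟩ : ∀ {X} U → All (⟨ X ⟩) U → ∀ {g} → g ∈Σ₀ U → ⟨ X ⟩ g
  Σ₀⊆⟨⟩ []      _           (here g≈ε) = resp (sym g≈ε) unit
  Σ₀⊆⟨⟩ (x ∷ U) (x∈ ∷ U⊆X) g∈ with Any-Σ₀-∷⁻ {x = x} {U} g∈
  ... | inj₁ g∈′ = Σ₀⊆⟨⟩ U U⊆X g∈′
  ... | inj₂ g∈′ with z , z∈ , g≈x∙z ← find g∈′ = resp (sym g≈x∙z) (mul x∈ (Σ₀⊆⟨⟩ U U⊆X z∈))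

  _∈Σ₀?_ : ∀ g U → Dec (g ∈Σ₀ U)
  g ∈Σ₀? U = any? (g ≟_) (Σ₀list U)

  -- ∣Σ₀ U ∣ is, by definition, length (enumΣ₀ U).
  enumΣ₀ : Seq → List Carrier
  enumΣ₀ U = filter (_∈Σ₀? U) elems

  enumΣ₀-unique : ∀ U → Unique (enumΣ₀ U)
  enumΣ₀-unique U = AllPairs.filter⁺ (_∈Σ₀? U) distinct

  enumΣ₀-sound : ∀ U → All (_∈Σ₀ U) (enumΣ₀ U)
  enumΣ₀-sound U = All.all-filter (_∈Σ₀? U) elems

  enumΣ₀-complete : ∀ U {g} → g ∈Σ₀ U → g ∈ enumΣ₀ U
  enumΣ₀-complete U {g} g∈ = ∈-filter⁺ setoid (_∈Σ₀? U) (λ x≈y → Any.map (trans (sym x≈y))) (complete g) g∈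

module Cosets {c ℓ} (G : FiniteAbelianGroup c ℓ) (S : FiniteAbelianGroup.Seq G) where
  open FiniteAbelianGroup G
  open FiniteAbelianGroupProperties G
  open SubsetSums G
  open UniqueLists setoid using (Unique; unique-⊆⇒length-≤)
  open import Algebra.Properties.Group group
    using (ε⁻¹≈ε; x≈y⇒x∙y⁻¹≈ε; ⁻¹-anti-homo-//; //-rightDividesʳ; ∙-cancelˡ)
  open import Algebra.Properties.AbelianGroup abGroup using (⁻¹-∙-comm)
  open import Algebra.Properties.CommutativeSemigroup commutativeSemigroup using (interchange; x∙yz≈y∙xz)
  open import Data.List.Membership.Setoid setoid using (find)
  open import Data.List.Relation.Binary.Pointwise as Pointwise using (Pointwise; []; _∷_)
  import Relation.Binary.Reasoning.Setoid setoid as ≈-Reasoning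

  -- In names below, H stands for ⟨S⟩.
  infix 4 _~_
  _~_ : Carrier → Carrier → Set (c ⊔ ℓ)
  x ~ y = ⟨ S ⟩ (x ∙ y ⁻¹)

  ≈⇒~ : ∀ {x y} → x ≈ y → x ~ y
  ≈⇒~ x≈y = resp (sym (x≈y⇒x∙y⁻¹≈ε x≈y)) unit

  ~-refl : ∀ {x} → x ~ x
  ~-refl = ≈⇒~ refl

  ~-sym : ∀ {x y} → x ~ y → y ~ x
  ~-sym {x} {y} x~y = resp (⁻¹-anti-homo-// x y) (inv x~y)

  ~-trans : ∀ {x y z} → x ~ y → y ~ z → x ~ z
  ~-trans {x} {y} {z} x~y y~z = resp x∙y⁻¹∙[y∙z⁻¹]≈x∙z⁻¹ (mul x~y y~z)
    where
      x∙y⁻¹∙[y∙z⁻¹]≈x∙z⁻¹ : (x ∙ y ⁻¹) ∙ (y ∙ z ⁻¹) ≈ x ∙ z ⁻¹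
      x∙y⁻¹∙[y∙z⁻¹]≈x∙z⁻¹ = begin
        (x ∙ y ⁻¹) ∙ (y ∙ z ⁻¹)  ≈⟨ ∙-congˡ (comm y (z ⁻¹)) ⟩
        (x ∙ y ⁻¹) ∙ (z ⁻¹ ∙ y)  ≈⟨ interchange x (y ⁻¹) (z ⁻¹) y ⟩
        (x ∙ z ⁻¹) ∙ (y ⁻¹ ∙ y)  ≈⟨ ∙-congˡ (inverseˡ y) ⟩
        (x ∙ z ⁻¹) ∙ ε           ≈⟨ identityʳ _ ⟩
        x ∙ z ⁻¹                 ∎
        where open ≈-Reasoning

  ~-∙ʳ : ∀ {x y} z → x ~ y → x ∙ z ~ y ∙ z
  ~-∙ʳ {x} {y} z x~y = resp (sym x∙z∙[y∙z]⁻¹≈x∙y⁻¹) x~y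
    where
      x∙z∙[y∙z]⁻¹≈x∙y⁻¹ : (x ∙ z) ∙ (y ∙ z) ⁻¹ ≈ x ∙ y ⁻¹
      x∙z∙[y∙z]⁻¹≈x∙y⁻¹ = begin
        (x ∙ z) ∙ (y ∙ z) ⁻¹       ≈⟨ ∙-congˡ (⁻¹-∙-comm y z) ⟨
        (x ∙ z) ∙ (y ⁻¹ ∙ z ⁻¹)    ≈⟨ interchange x z (y ⁻¹) (z ⁻¹) ⟩
        (x ∙ y ⁻¹) ∙ (z ∙ z ⁻¹)    ≈⟨ ∙-congˡ (inverseʳ z) ⟩
        (x ∙ y ⁻¹) ∙ ε             ≈⟨ identityʳ _ ⟩
        x ∙ y ⁻¹                   ∎
        where open ≈-Reasoning

  ~-∙ˡ : ∀ {x y} z → x ~ y → z ∙ x ~ z ∙ y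
  ~-∙ˡ {x} {y} z x~y = ~-trans (≈⇒~ (comm z x)) (~-trans (~-∙ʳ z x~y) (≈⇒~ (comm y z)))

  ~-∙ : ∀ {x y z w} → x ~ y → z ~ w → x ∙ z ~ y ∙ w
  ~-∙ {y = y} {z} x~y z~w = ~-trans (~-∙ʳ z x~y) (~-∙ˡ y z~w)

  ~-cancelʳ : ∀ {x y} z → x ∙ z ~ y ∙ z → x ~ y
  ~-cancelʳ {x} {y} z x∙z~y∙z =
    ~-trans (≈⇒~ (sym (//-rightDividesʳ z x))) (~-trans (~-∙ʳ (z ⁻¹) x∙z~y∙z) (≈⇒~ (//-rightDividesʳ z y)))

  ~-⁻¹ : ∀ {x y} → x ~ y → x ⁻¹ ~ y ⁻¹
  ~-⁻¹ {x} {y} x~y = resp (sym (⁻¹-∙-comm x (y ⁻¹))) (inv x~y)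

  private
    x∙ε⁻¹≈x : ∀ x → x ∙ ε ⁻¹ ≈ x
    x∙ε⁻¹≈x x = trans (∙-congˡ ε⁻¹≈ε) (identityʳ x)

  ∈⟨S⟩⇒~ε : ∀ {x} → ⟨ S ⟩ x → x ~ ε
  ∈⟨S⟩⇒~ε {x} = resp (sym (x∙ε⁻¹≈x x))

  ~ε⇒∈⟨S⟩ : ∀ {x} → x ~ ε → ⟨ S ⟩ x
  ~ε⇒∈⟨S⟩ {x} = resp (x∙ε⁻¹≈x x)

  infix 4 _∈Σ₀+H_
  _∈Σ₀+H_ : Carrier → Seq → Set (c ⊔ ℓ)
  y ∈Σ₀+H U = Any (y ~_) (Σ₀list U)

  Incongruent : List Carrier → Set (c ⊔ ℓ)
  Incongruent = AllPairs (λ x y → ¬ x ~ y)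

  -- |φ(Σ₀(U))| ≥ m for the quotient map φ : G → G/⟨S⟩, witnessed by m representatives of cosets.
  record MeetsCosets (U : Seq) (m : ℕ) : Set (c ⊔ ℓ) where
    constructor meets
    field
      cosets      : List Carrier
      m≤#cosets   : m ≤ length cosets
      incongruent : Incongruent cosets
      met         : All (_∈Σ₀+H U) cosets

  MeetsCosets-∷ : ∀ {x U m} → MeetsCosets U m → MeetsCosets (x ∷ U) m
  MeetsCosets-∷ {x} {U} (meets E m≤|E| incE E⊆) = meets E m≤|E| incE (All.map (Any-Σ₀-∷⁺ˡ {x = x} {U}) E⊆)

  MeetsCosets-≤ : ∀ {U m n} → n ≤ m → MeetsCosets U m → MeetsCosets U n
  MeetsCosets-≤ n≤m (meets E m≤|E| incE E⊆) = meets E (ℕ.≤-trans n≤m m≤|E|) incE E⊆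

  ⟨S⟩-terms : All (⟨ S ⟩) S
  ⟨S⟩-terms = All.tabulate (λ x∈S → gen (Any.map reflexive x∈S))

  ∙-Σ₀S-~ : ∀ d {b} → b ∈Σ₀ S → d ∙ b ~ d
  ∙-Σ₀S-~ d b∈ = ~-trans (~-∙ˡ d (∈⟨S⟩⇒~ε (Σ₀⊆⟨⟩ S ⟨S⟩-terms b∈))) (≈⇒~ (identityʳ d))

  ⊕Σ₀S-near : ∀ D → All (λ y → Any (y ~_) D) (D ⊕ enumΣ₀ S)
  ⊕Σ₀S-near []      = []
  ⊕Σ₀S-near (d ∷ D) =
    All.++⁺ (All.map⁺ (All.map (λ b∈ → here (∙-Σ₀S-~ d b∈)) (enumΣ₀-sound S))) (All.map there (⊕Σ₀S-near D))

  ⊕Σ₀S-unique : ∀ D → Incongruent D → Unique (D ⊕ enumΣ₀ S)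
  ⊕Σ₀S-unique []      []            = []
  ⊕Σ₀S-unique (d ∷ D) (d≁D ∷ incD) =
    AllPairs.++⁺ (AllPairs.map⁺ (AllPairs.map (λ b≉b′ d∙b≈d∙b′ → b≉b′ (∙-cancelˡ d _ _ d∙b≈d∙b′))
                                              (enumΣ₀-unique S)))
                 (⊕Σ₀S-unique D incD)
                 (All.map⁺ (All.map (λ b∈ → All.map (far b∈) (⊕Σ₀S-near D)) (enumΣ₀-sound S)))
    where
      far : ∀ {b y} → b ∈Σ₀ S → Any (y ~_) D → ¬ d ∙ b ≈ y
      far {y = y} b∈ y~D d∙b≈y = All.lookupWith (λ d≁d′ y~d′ → d≁d′ (~-trans d~y y~d′)) d≁D y~D
        where
          d~y : d ~ y
          d~y = ~-trans (~-sym (∙-Σ₀S-~ d b∈)) (≈⇒~ d∙b≈y)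

  ~-∈-⊕ : ∀ {g D B} → (∀ {h} → ⟨ S ⟩ h → h ∈ B) → Any (g ~_) D → g ∈ D ⊕ B
  ~-∈-⊕ {g} H⊆B g~D with d , d∈D , g~d ← find g~D =
    Any.map (trans g≈d∙[g∙d⁻¹]) (∈-⊕⁺ d∈D (H⊆B g~d))
    where
      g≈d∙[g∙d⁻¹] : g ≈ d ∙ (g ∙ d ⁻¹)
      g≈d∙[g∙d⁻¹] = sym (trans (x∙yz≈y∙xz d g (d ⁻¹)) (trans (∙-congˡ (inverseʳ d)) (identityʳ g)))

  Incongruent-transport : ∀ {E D} → Pointwise _~_ E D → Incongruent E → Incongruent D
  Incongruent-transport []            []            = []
  Incongruent-transport (e~d ∷ E~D) (e≁E ∷ incE) = d≁D E~D e≁E ∷ Incongruent-transport E~D incE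
    where
      d≁D : ∀ {E′ D′} → Pointwise _~_ E′ D′ → All (λ e′ → ¬ _ ~ e′) E′ → All (λ d′ → ¬ _ ~ d′) D′
      d≁D []              []            = []
      d≁D (e′~d′ ∷ E′~D′) (e≁e′ ∷ e≁E′) =
        (λ d~d′ → e≁e′ (~-trans e~d (~-trans d~d′ (~-sym e′~d′)))) ∷ d≁D E′~D′ e≁E′

  representatives : ∀ U E → All (_∈Σ₀+H U) E → ∃ λ D → Pointwise _~_ E D × All (_∈Σ₀ U) D
  representatives U []      []         = [] , [] , []
  representatives U (e ∷ E) (e∈ ∷ E⊆)
    with d , d∈ , e~d ← find e∈ | D , E~D , D⊆ ← representatives U E E⊆ = d ∷ D , e~d ∷ E~D , d∈ ∷ D⊆

  -- The cosets met by Σ₀(T) have disjoint translates by Σ₀(S) inside Σ₀(T·S).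
  MeetsCosets⇒∣Σ₀∣-bound : ∀ T {m} → MeetsCosets T m → m * ∣Σ₀ S ∣ ≤ ∣Σ₀ T ++ S ∣
  MeetsCosets⇒∣Σ₀∣-bound T {m} (meets E m≤|E| incE E⊆) with D , E~D , D⊆ ← representatives T E E⊆ = begin
    m * ∣Σ₀ S ∣             ≤⟨ ℕ.*-monoˡ-≤ ∣Σ₀ S ∣ m≤|E| ⟩
    length E * ∣Σ₀ S ∣      ≡⟨ ≡.cong (_* ∣Σ₀ S ∣) (Pointwise.Pointwise-length E~D) ⟩
    length D * ∣Σ₀ S ∣      ≡⟨ length-⊕ D (enumΣ₀ S) ⟨
    length (D ⊕ enumΣ₀ S)   ≤⟨ unique-⊆⇒length-≤ (⊕Σ₀S-unique D (Incongruent-transport E~D incE))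
                                 (All.map (enumΣ₀-complete (T ++ S)) D⊕Σ₀S⊆Σ₀T·S) ⟩
    ∣Σ₀ T ++ S ∣            ∎
    where
      open ℕ.≤-Reasoning
      D⊕Σ₀S⊆Σ₀T·S : All (_∈Σ₀ (T ++ S)) (D ⊕ enumΣ₀ S)
      D⊕Σ₀S⊆Σ₀T·S = All-⊕⁺ (All.map (λ d∈ → All.map (∙-∈Σ₀-++ T d∈) (enumΣ₀-sound S)) D⊆)

module Growth {c ℓ} (G : FiniteAbelianGroup c ℓ) (S : FiniteAbelianGroup.Seq G) where
  open FiniteAbelianGroup G
  open FiniteAbelianGroupProperties G
  open SubsetSums G
  open Cosets G S
  open import Algebra.Properties.Group group using (\\-leftDividesʳ)
  open import Data.List.Membership.Setoid setoid using (find)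
  open import Data.List.Membership.Setoid.Properties using (∈-length)
  open import Data.Nat.DivMod using (_%_; _/_; m≡m%n+[m/n]*n; m%n<n)
  open import Relation.Nullary.Decidable using (_×-dec_)
  open import Function using (id)
  open UniqueLists setoid using (unique-⊆⇒length-≤)

  multiples : ℕ → Carrier → List Carrier
  multiples n x = applyUpTo (_· x) n

  length-multiples : ∀ n x → length (multiples n x) ≡ n
  length-multiples n x = List.length-applyUpTo (_· x) n

  multiples-incongruent : ∀ n {x} → (∀ {m} → 1 ≤ m → m < n → ¬ ⟨ S ⟩ (m · x)) → Incongruent (multiples n x)
  multiples-incongruent n {x} ·∉ = AllPairs.applyUpTo⁺₁ (_· x) n λ {i} {j} i<j j<n ix~jx →
    ·∉ (ℕ.m<n⇒0<n∸m i<j) (ℕ.≤-<-trans (ℕ.m∸n≤m j i) j<n)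
       (~ε⇒∈⟨S⟩ (~-cancelʳ (i · x) (~-trans (≈⇒~ (difference i j (ℕ.<⇒≤ i<j)))
                                            (~-trans (~-sym ix~jx) (≈⇒~ (sym (identityˡ (i · x))))))))
    where
      difference : ∀ i j → i ≤ j → (j ∸ i) · x ∙ i · x ≈ j · x
      difference i j i≤j = trans (sym (×-homo-+ x (j ∸ i) i)) (reflexive (≡.cong (_· x) (ℕ.m∸n+n≡m i≤j)))

  ·-mod : ∀ {x} m → .{{_ : NonZero m}} → ⟨ S ⟩ (m · x) → ∀ k → k · x ~ (k % m) · x
  ·-mod {x} m mx∈ k =
    ~-trans (≈⇒~ (trans (reflexive (≡.cong (_· x) (m≡m%n+[m/n]*n k m))) (×-homo-+ x (k % m) ((k / m) * m))))
            (~-trans (~-∙ˡ ((k % m) · x) (∈⟨S⟩⇒~ε (⟨⟩-·-*-closed (k / m) m mx∈))) (≈⇒~ (identityʳ _)))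

  ~-multiples-mod : ∀ {x} m → .{{_ : NonZero m}} → ⟨ S ⟩ (m · x) →
                    ∀ {z} k → z ~ k · x → Any (z ~_) (multiples m x)
  ~-multiples-mod {x} m mx∈ k z~kx = Any.applyUpTo⁺ (_· x) (~-trans z~kx (·-mod m mx∈ k)) (m%n<n k m)

  -- Exponents are taken below |G|, so that membership is decidable.
  infix 4 _∈⟨_⟩+H
  _∈⟨_⟩+H : Carrier → Carrier → Set (c ⊔ ℓ)
  z ∈⟨ x ⟩+H = Any (z ~_) (multiples order x)

  ∈⟨⟩+H-intro : ∀ {x z} k → z ~ k · x → z ∈⟨ x ⟩+H
  ∈⟨⟩+H-intro {x} = ~-multiples-mod order (resp (sym (order·≈ε x)) unit)

  ∈⟨⟩+H-refl : ∀ {x} → x ∈⟨ x ⟩+H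
  ∈⟨⟩+H-refl {x} = ∈⟨⟩+H-intro 1 (≈⇒~ (sym (identityʳ x)))

  ∈⟨⟩+H-∙ : ∀ {x y z} → y ∈⟨ x ⟩+H → z ∈⟨ x ⟩+H → y ∙ z ∈⟨ x ⟩+H
  ∈⟨⟩+H-∙ {x} y∈ z∈ with i , _ , y~ix ← Any.applyUpTo⁻ (_· x) y∈ | j , _ , z~jx ← Any.applyUpTo⁻ (_· x) z∈ =
    ∈⟨⟩+H-intro (i + j) (~-trans (~-∙ y~ix z~jx) (≈⇒~ (sym (×-homo-+ x i j))))

  ∈⟨⟩+H-⁻¹ : ∀ {x g} → g ∈⟨ x ⟩+H → g ⁻¹ ∈⟨ x ⟩+H
  ∈⟨⟩+H-⁻¹ {x} g∈ with i , i<order , g~ix ← Any.applyUpTo⁻ (_· x) g∈ =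
    ∈⟨⟩+H-intro (order ∸ i) (~-trans (~-⁻¹ g~ix) (≈⇒~ (sym (·-∸-inverse x (ℕ.<⇒≤ i<order)))))

  ⟨T·S⟩⊆⟨x⟩+H : ∀ T {x} → All (_∈⟨ x ⟩+H) (Σ₀list T) → ∀ {g} → ⟨ T ++ S ⟩ g → g ∈⟨ x ⟩+H
  ⟨T·S⟩⊆⟨x⟩+H T Σ₀⊆ (gen g∈T·S) with Any.++⁻ T g∈T·S
  ... | inj₁ g∈T = All.lookupWith (λ y∈ g≈y → Any.map (~-trans (≈⇒~ g≈y)) y∈) Σ₀⊆ (term∈Σ₀ T g∈T)
  ... | inj₂ g∈S = ∈⟨⟩+H-intro 0 (∈⟨S⟩⇒~ε (gen g∈S))
  ⟨T·S⟩⊆⟨x⟩+H T Σ₀⊆ unit          = ∈⟨⟩+H-intro 0 ~-refl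
  ⟨T·S⟩⊆⟨x⟩+H T Σ₀⊆ (mul g∈ h∈)   = ∈⟨⟩+H-∙ (⟨T·S⟩⊆⟨x⟩+H T Σ₀⊆ g∈) (⟨T·S⟩⊆⟨x⟩+H T Σ₀⊆ h∈)
  ⟨T·S⟩⊆⟨x⟩+H T Σ₀⊆ (inv g∈)      = ∈⟨⟩+H-⁻¹ (⟨T·S⟩⊆⟨x⟩+H T Σ₀⊆ g∈)
  ⟨T·S⟩⊆⟨x⟩+H T Σ₀⊆ (resp g≈h g∈) = Any.map (~-trans (≈⇒~ (sym g≈h))) (⟨T·S⟩⊆⟨x⟩+H T Σ₀⊆ g∈)

  ∈Σ₀⇒∈Σ₀+H : ∀ {U z} → z ∈Σ₀ U → z ∈Σ₀+H U
  ∈Σ₀⇒∈Σ₀+H = Any.map ≈⇒~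

  ∈Σ₀+H-resp : ∀ {U y y′} → y ~ y′ → y ∈Σ₀+H U → y′ ∈Σ₀+H U
  ∈Σ₀+H-resp y~y′ = Any.map (~-trans (~-sym y~y′))

  escape-grows : ∀ {x U m} → MeetsCosets U m → ∀ {z} → z ∈Σ₀ U → ¬ x ∙ z ∈Σ₀+H U → MeetsCosets (x ∷ U) (suc m)
  escape-grows {x} {U} (meets E m≤|E| incE E⊆) z∈ x∙z∉ = meets (x ∙ _ ∷ E) (s≤s m≤|E|)
    (All.map (λ e∈ x∙z~e → x∙z∉ (∈Σ₀+H-resp {U} (~-sym x∙z~e) e∈)) E⊆ ∷ incE)
    (Any-Σ₀-∷⁺ʳ {x = x} {U} (Any.map (λ z≈w → ≈⇒~ (∙-congˡ z≈w)) z∈) ∷ All.map (Any-Σ₀-∷⁺ˡ {x = x} {U}) E⊆)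

  Invariant : Seq → Carrier → Set (c ⊔ ℓ)
  Invariant U x = ∀ {y} → y ∈Σ₀+H U → x ∙ y ∈Σ₀+H U

  invariant-· : ∀ {U x} → Invariant U x → ∀ i {y} → y ∈Σ₀+H U → i · x ∙ y ∈Σ₀+H U
  invariant-· {U} inv-x zero    y∈ = ∈Σ₀+H-resp {U} (≈⇒~ (sym (identityˡ _))) y∈
  invariant-· {U} inv-x (suc i) y∈ =
    ∈Σ₀+H-resp {U} (≈⇒~ (sym (assoc _ _ _))) (inv-x (invariant-· {U} inv-x i y∈))

  invariant-multiples : ∀ {U x} → Invariant U x → ∀ i → i · x ∈Σ₀+H U
  invariant-multiples {U} inv-x i =
    ∈Σ₀+H-resp {U} (≈⇒~ (identityʳ _)) (invariant-· {U} inv-x i (∈Σ₀⇒∈Σ₀+H {U} (ε∈Σ₀ U)))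

  invariant-∈⟨⟩+H : ∀ {U x w} → Invariant U x → w ∈⟨ x ⟩+H → Invariant U w
  invariant-∈⟨⟩+H {U} {x} inv-x w∈ {y} y∈ with i , _ , w~ix ← Any.applyUpTo⁻ (_· x) w∈ =
    ∈Σ₀+H-resp {U} (~-sym (~-∙ʳ y w~ix)) (invariant-· {U} inv-x i y∈)

  invariant-absorbs : ∀ {U w y} → Invariant U w → y ∈Σ₀+H (w ∷ U) → y ∈Σ₀+H U
  invariant-absorbs {U} {w} inv-w y∈ with Any-Σ₀-∷⁻ {x = w} {U} y∈
  ... | inj₁ y∈′ = y∈′
  ... | inj₂ y∈′ with z , z∈ , y~w∙z ← find y∈′ = ∈Σ₀+H-resp {U} (~-sym y~w∙z) (inv-w (∈Σ₀⇒∈Σ₀+H {U} z∈))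

  invariant-∷ : ∀ {U x w} → Invariant U x → Invariant U w → Invariant (w ∷ U) x
  invariant-∷ {U} {x} {w} inv-x inv-w y∈ = Any-Σ₀-∷⁺ˡ {x = w} {U} (inv-x (invariant-absorbs {U} inv-w y∈))

  record Saturated (U : Seq) : Set (c ⊔ ℓ) where
    constructor saturated
    field
      generator   : Carrier
      generator∉H : ¬ ⟨ S ⟩ generator
      invariant   : Invariant U generator
      Σ₀⊆⟨gen⟩+H  : All (_∈⟨ generator ⟩+H) (Σ₀list U)

  saturated-∷ : ∀ {U x w} → ¬ ⟨ S ⟩ x → Invariant U x → All (_∈⟨ x ⟩+H) (Σ₀list U) → w ∈⟨ x ⟩+H →
                Saturated (w ∷ U)
  saturated-∷ {U} {x} {w} x∉ inv-x Σ₀⊆ w∈ = saturated x x∉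
    (invariant-∷ {U} inv-x (invariant-∈⟨⟩+H {U} inv-x w∈))
    (All-Σ₀-∷⁺ {x = w} {U} Σ₀⊆ (All.map (∈⟨⟩+H-∙ w∈) Σ₀⊆))

  module Bounds (H? : ∀ g → Dec (⟨ S ⟩ g)) {p} (p≤order : p ≤ order)
                (·∉⟨S⟩ : ∀ {x} → ¬ ⟨ S ⟩ x → ∀ {m} → 1 ≤ m → m < p → ¬ ⟨ S ⟩ (m · x)) where

    _~?_ : ∀ x y → Dec (x ~ y)
    x ~? y = H? (x ∙ y ⁻¹)

    _∈Σ₀+H?_ : ∀ y U → Dec (y ∈Σ₀+H U)
    y ∈Σ₀+H? U = any? (y ~?_) (Σ₀list U)

    _∈⟨_⟩+H? : ∀ z x → Dec (z ∈⟨ x ⟩+H)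
    z ∈⟨ x ⟩+H? = any? (z ~?_) (multiples order x)

    invariant-or-escape : ∀ U x → Invariant U x ⊎ ∃ λ z → z ∈Σ₀ U × ¬ x ∙ z ∈Σ₀+H U
    invariant-or-escape U x with All.all? (λ z → (x ∙ z) ∈Σ₀+H? U) (Σ₀list U)
    ... | yes all-in =
      inj₁ λ y∈ → All.lookupWith (λ x∙z∈ y~z → ∈Σ₀+H-resp {U} (~-sym (~-∙ˡ x y~z)) x∙z∈) all-in y∈
    ... | no ¬all-in = inj₂ (find (All.¬All⇒Any¬ (λ z → (x ∙ z) ∈Σ₀+H? U) (Σ₀list U) ¬all-in))

    invariant⇒MeetsCosets-p : ∀ {U x} → ¬ ⟨ S ⟩ x → Invariant U x → MeetsCosets U p
    invariant⇒MeetsCosets-p {U} {x} x∉ inv-x =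
      meets (multiples p x) (ℕ.≤-reflexive (≡.sym (length-multiples p x)))
            (multiples-incongruent p (·∉⟨S⟩ x∉)) (All.applyUpTo⁺₂ (_· x) p (invariant-multiples {U} inv-x))

    -- The cosets of i x and of i x ∙ z, 0 ≤ i < p, are 2p distinct cosets.
    two-cosets : ∀ {V x z} → ¬ ⟨ S ⟩ x → ¬ z ∈⟨ x ⟩+H →
                 (∀ i → i · x ∈Σ₀+H V) → (∀ i → i · x ∙ z ∈Σ₀+H V) → MeetsCosets V (2 * p)
    two-cosets {V} {x} {z} x∉ z∉ ix∈ ix∙z∈ =
      meets (multiples p x ++ map (_∙ z) (multiples p x)) (ℕ.≤-reflexive (≡.sym length-E))
        (AllPairs.++⁺ incongruent (AllPairs.map⁺ (AllPairs.map (λ ≁ ~∙z → ≁ (~-cancelʳ z ~∙z)) incongruent))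
                      cross)
        (All.++⁺ (All.applyUpTo⁺₂ (_· x) p ix∈) (All.map⁺ (All.applyUpTo⁺₂ (_· x) p ix∙z∈)))
      where
        incongruent : Incongruent (multiples p x)
        incongruent = multiples-incongruent p (·∉⟨S⟩ x∉)

        length-E : length (multiples p x ++ map (_∙ z) (multiples p x)) ≡ 2 * p
        length-E = ≡.trans (List.length-++ (multiples p x))
                           (≡.cong₂ _+_ (length-multiples p x)
                                        (≡.trans (List.length-map (_∙ z) (multiples p x))
                                                 (≡.trans (length-multiples p x) (≡.sym (ℕ.+-identityʳ p)))))

        cancel : ∀ j → j ≤ order → (order ∸ j) · x ∙ (j · x ∙ z) ≈ z
        cancel j j≤order = trans (∙-congʳ (·-∸-inverse x j≤order)) (\\-leftDividesʳ (j · x) z)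

        cross : All (λ a → All (λ b → ¬ a ~ b) (map (_∙ z) (multiples p x))) (multiples p x)
        cross = All.applyUpTo⁺₁ (_· x) p λ {i} _ → All.map⁺ (All.applyUpTo⁺₁ (_· x) p λ {j} j<p ix~jx∙z →
          z∉ (∈⟨⟩+H-intro (order ∸ j + i)
               (~-trans (≈⇒~ (sym (cancel j (ℕ.≤-trans (ℕ.<⇒≤ j<p) p≤order))))
               (~-trans (~-∙ˡ ((order ∸ j) · x) (~-sym ix~jx∙z))
                        (≈⇒~ (sym (×-homo-+ x (order ∸ j) i)))))))

    invariant-∉⟨⟩+H⇒MeetsCosets-2p : ∀ {U x z} → ¬ ⟨ S ⟩ x → Invariant U x →
                                     z ∈Σ₀ U → ¬ z ∈⟨ x ⟩+H → MeetsCosets U (2 * p)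
    invariant-∉⟨⟩+H⇒MeetsCosets-2p {U} x∉ inv-x z∈ z∉ = two-cosets x∉ z∉ (invariant-multiples {U} inv-x)
      (λ i → invariant-· {U} inv-x i (∈Σ₀⇒∈Σ₀+H {U} z∈))

    invariant-∉⟨⟩+H⇒MeetsCosets-∷-2p : ∀ {U x w} → ¬ ⟨ S ⟩ x → Invariant U x →
                                       ¬ w ∈⟨ x ⟩+H → MeetsCosets (w ∷ U) (2 * p)
    invariant-∉⟨⟩+H⇒MeetsCosets-∷-2p {U} {x} {w} x∉ inv-x w∉ = two-cosets x∉ w∉
      (λ i → Any-Σ₀-∷⁺ˡ {x = w} {U} (invariant-multiples {U} inv-x i))
      (λ i → ∈Σ₀+H-resp {w ∷ U} (≈⇒~ (comm w (i · x)))
                        (Any-Σ₀-∷⁺ʳ {x = w} {U} (Any.map (~-∙ˡ w) (invariant-multiples {U} inv-x i))))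

    Progress : Seq → Set (c ⊔ ℓ)
    Progress U = MeetsCosets U (suc (length U)) ⊎ MeetsCosets U (2 * p) ⊎ Saturated U

    progress-∷ : ∀ {x U} → ¬ ⟨ S ⟩ x → Progress U → Progress (x ∷ U)
    progress-∷ {x} {U} x∉ (inj₁ U-meets) with invariant-or-escape U x
    ... | inj₂ (z , z∈ , x∙z∉) = inj₁ (escape-grows U-meets z∈ x∙z∉)
    ... | inj₁ inv-x with All.all? (_∈⟨ x ⟩+H?) (Σ₀list U)
    ...   | yes Σ₀⊆ = inj₂ (inj₂ (saturated-∷ {U} x∉ inv-x Σ₀⊆ ∈⟨⟩+H-refl))
    ...   | no ¬Σ₀⊆ with z , z∈ , z∉ ← find (All.¬All⇒Any¬ (_∈⟨ x ⟩+H?) (Σ₀list U) ¬Σ₀⊆) =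
      inj₂ (inj₁ (MeetsCosets-∷ (invariant-∉⟨⟩+H⇒MeetsCosets-2p x∉ inv-x z∈ z∉)))
    progress-∷ _ (inj₂ (inj₁ U-meets)) = inj₂ (inj₁ (MeetsCosets-∷ U-meets))
    progress-∷ {w} {U} _ (inj₂ (inj₂ (saturated x x∉ inv-x Σ₀⊆))) with w ∈⟨ x ⟩+H?
    ... | yes w∈ = inj₂ (inj₂ (saturated-∷ {U} x∉ inv-x Σ₀⊆ w∈))
    ... | no  w∉ = inj₂ (inj₁ (invariant-∉⟨⟩+H⇒MeetsCosets-∷-2p {U} x∉ inv-x w∉))

    progress : ∀ U → All (λ g → ¬ ⟨ S ⟩ g) U → Progress U
    progress []      []         = inj₁ (meets [ ε ] ℕ.≤-refl ([] ∷ []) (here ~-refl ∷ []))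
    progress (x ∷ U) (x∉ ∷ U∉) = progress-∷ x∉ (progress U U∉)

    -- |⟨T·S⟩ / ⟨S⟩| ≥ 2p
    LargeQuotient : Seq → Set (c ⊔ ℓ)
    LargeQuotient T = ∃ λ HS → ∃ λ HTS →
      Enumerates ⟨ S ⟩ HS × Enumerates ⟨ T ++ S ⟩ HTS × 2 * p * length HS ≤ length HTS

    -- Either the multiples m x, 0 ≤ m < 2p, are pairwise incongruent, or some m x with 1 ≤ m < 2p lies in H;
    -- then ⟨T·S⟩ is covered by the m cosets k x + H, k < m, which is too few.
    saturated⇒MeetsCosets-2p : ∀ T → Saturated T → LargeQuotient T → MeetsCosets T (2 * p)
    saturated⇒MeetsCosets-2p T (saturated x x∉ inv-x Σ₀⊆)
                             (HS , HTS , (_ , _ , HS-complete) , (HTS-unique , HTS⊆ , _) , 2p|HS|≤|HTS|)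
      with any? (λ m → 1 ℕ.≤? m ×-dec H? (m · x)) (upTo (2 * p))
    ... | no ∄small = meets (multiples (2 * p) x) (ℕ.≤-reflexive (≡.sym (length-multiples (2 * p) x)))
      (multiples-incongruent (2 * p) λ 1≤m m<2p mx∈ → ∄small (Any.applyUpTo⁺ id (1≤m , mx∈) m<2p))
      (All.applyUpTo⁺₂ (_· x) (2 * p) (invariant-multiples {T} inv-x))
    ... | yes small with m , m<2p , 1≤m , mx∈ ← Any.applyUpTo⁻ id small =
      ⊥-elim (ℕ.<-irrefl ≡.refl (begin-strict
        length HTS                          ≤⟨ unique-⊆⇒length-≤ HTS-unique (All.map cover HTS⊆) ⟩
        length (multiples m x ⊕ HS)         ≡⟨ length-⊕ (multiples m x) HS ⟩
        length (multiples m x) * length HS  ≡⟨ ≡.cong (_* length HS) (length-multiples m x) ⟩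
        m * length HS                       <⟨ ℕ.*-monoˡ-< (length HS) {{HS-nonZero}} m<2p ⟩
        2 * p * length HS                   ≤⟨ 2p|HS|≤|HTS| ⟩
        length HTS                          ∎))
      where
        open ℕ.≤-Reasoning
        HS-nonZero : NonZero (length HS)
        HS-nonZero = >-nonZero (∈-length setoid (HS-complete ε unit))
        cover : ∀ {g} → ⟨ T ++ S ⟩ g → g ∈ multiples m x ⊕ HS
        cover g∈ with i , _ , g~ix ← Any.applyUpTo⁻ (_· x) (⟨T·S⟩⊆⟨x⟩+H T Σ₀⊆ g∈) =
          ~-∈-⊕ (HS-complete _) (~-multiples-mod m {{>-nonZero 1≤m}} mx∈ i g~ix)

    MeetsCosets-|T|+1 : ∀ T → All (λ g → ¬ ⟨ S ⟩ g) T →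
                        suc (length T) ≤ p ⊎ (suc (length T) ≤ 2 * p × LargeQuotient T) →
                        MeetsCosets T (suc (length T))
    MeetsCosets-|T|+1 T T∉ small-T with progress T T∉
    ... | inj₁ T-meets = T-meets
    ... | inj₂ (inj₁ T-meets-2p) = MeetsCosets-≤ |T|<2p T-meets-2p
      where
        |T|<2p : suc (length T) ≤ 2 * p
        |T|<2p = [ (λ |T|<p → ℕ.≤-trans |T|<p (ℕ.m≤m+n p (p + 0))) , proj₁ ]′ small-T
    ... | inj₂ (inj₂ T-sat@(saturated _ x∉ inv-x _)) with small-T
    ...   | inj₁ |T|<p                = MeetsCosets-≤ |T|<p (invariant⇒MeetsCosets-p {T} x∉ inv-x)
    ...   | inj₂ (|T|<2p , large-T)   = MeetsCosets-≤ |T|<2p (saturated⇒MeetsCosets-2p T T-sat large-T)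

corollary3p3 : ∀ {c ℓ} (G : FiniteAbelianGroup c ℓ) → let open FiniteAbelianGroup G in
    (p : ℕ) → Prime p → p ∣ order → (∀ q → Prime q → q ∣ order → p ≤ q) →
    (S T : Seq) → All (λ g → ¬ ⟨ S ⟩ g) T →
    (length T ≤ p ∸ 1
      ⊎ (length T ≤ 2 * p ∸ 1
         × Σ (List Carrier) (λ HS → Σ (List Carrier) (λ HTS →
             Enumerates ⟨ S ⟩ HS × Enumerates ⟨ T ++ S ⟩ HTS
             × 2 * p * length HS ≤ length HTS)))) →
    (length T + 1) * ∣Σ₀ S ∣ ≤ ∣Σ₀ T ++ S ∣
corollary3p3 G p p-prime p∣order p-minimal S T T∉H small-T =
  decidable-stable (_ ℕ.≤? _) λ ¬bound → ¬¬-decidable resp (λ H? → ¬bound (bound H?))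
  where
    open FiniteAbelianGroup G
    open FiniteAbelianGroupProperties G
    instance
      p-nonZero : NonZero p
      p-nonZero = prime⇒nonZero p-prime
    -- Membership in ⟨S⟩ need not be decidable, but the goal is, so we may assume it.
    bound : (∀ g → Dec (⟨ S ⟩ g)) → (length T + 1) * ∣Σ₀ S ∣ ≤ ∣Σ₀ T ++ S ∣
    bound H? = ≡.subst (λ k → k * ∣Σ₀ S ∣ ≤ ∣Σ₀ T ++ S ∣) (ℕ.+-comm 1 (length T))
      (MeetsCosets⇒∣Σ₀∣-bound T (MeetsCosets-|T|+1 T T∉H
        (Sum.map ℕ.m≤pred[n]⇒suc[m]≤n (Product.map₁ (ℕ.m≤pred[n]⇒suc[m]≤n {{ℕ.m*n≢0 2 p}})) small-T)))
      where
        open Cosets G S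
        open Growth.Bounds G S H? (∣⇒≤ p∣order) (·∉⟨⟩ p-minimal)
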